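{- $\vdash\Gamma$ is derivable in $\mathtt{CL}$ if and only if $\vdash\exists x\Gamma^*$ is derivable in $\mathtt{ALV}$.
   Context: $\mathtt{CL}$ is Tait-style classical propositional logic (initial sequents $\vdash\Gamma,P,\overline{P}$; from $\vdash\Gamma,A$ and $\vdash\Gamma,B$ infer $\vdash\Gamma,A\wedge B$; from $\vdash\Gamma,A,B$ infer $\vdash\Gamma,A\vee B$); $\Gamma$ is a finite multiset. $\mathtt{ALV}$ is affine logic (one-sided calculus with initial sequents $\vdash\Gamma,P,\overline{P}$, rules for $\oplus$, $\&$ (additive conjunction), $⅋$ (multiplicative disjunction), $\otimes$, $\forall$, $\exists$, no contraction) extended with vacuous quantifier rules on possibly infinite multisets: from $\vdash\Gamma,A^\infty$ infer $\vdash\Gamma,\exists xA$; from $\vdash\Gamma_i,A$ for all $i$ infer $\vdash\biguplus_i\Gamma_i,\forall xA$ ($A^\infty$ = infinitely many copies of $A$, $x$ not free in $A$). Translation $*$: $P^*=P$, $\overline{P}^*=\overline{P}$, $(A\vee B)^*=\exists xA^*⅋\exists yB^*$, $(A\wedge B)^*=\exists xA^*\otimes\exists yB^*$ (vacuous quantifiers); $\exists x\Gamma^*$ prefixes each formula of $\Gamma^*$ with a vacuous $\exists x$. -}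

module Defs where

open import Data.Nat using (ℕ)
open import Data.List using (List; []; _∷_; length; lookup)
open import Data.List.Relation.Binary.Permutation.Propositional using (_↭_)
open import Data.Fin using (Fin)
open import Data.Sum using (_⊎_; inj₁; inj₂)
open import Data.Product using (Σ; _,_)
open import Data.Unit using (⊤; tt)
open import Function.Bundles using (_↔_; Inverse)
open import Relation.Binary.PropositionalEquality using (_≡_)

data CForm : Set where
  pos  : ℕ → CForm
  neg  : ℕ → CForm
  _∧_  : CForm → CForm → CForm
  _∨_  : CForm → CForm → CForm

-- ⊢ Γ derivable in CL; the multiset structure is given by the exchange rule
data CL : List CForm → Set where
  ax    : ∀ {Γ} P → CL (pos P ∷ neg P ∷ Γ)
  ∧-rule : ∀ {Γ A B} → CL (A ∷ Γ) → CL (B ∷ Γ) → CL ((A ∧ B) ∷ Γ)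
  ∨-rule : ∀ {Γ A B} → CL (A ∷ B ∷ Γ) → CL ((A ∨ B) ∷ Γ)
  exch  : ∀ {Γ Δ} → Γ ↭ Δ → CL Γ → CL Δ

-- quantifiers are vacuous, so the bound variable name is omitted
data AForm : Set where
  pos  : ℕ → AForm
  neg  : ℕ → AForm
  _⊕_  : AForm → AForm → AForm
  _&_  : AForm → AForm → AForm
  _⅋_  : AForm → AForm → AForm
  _⊗_  : AForm → AForm → AForm
  ∀v   : AForm → AForm
  ∃v   : AForm → AForm

-- possibly infinite multisets of formulas: an index type with a labelling
record Ctx : Set₁ where
  constructor ctx
  field
    Idx : Set
    fm  : Idx → AForm
open Ctx public

-- multiset equality: a bijection of indices preserving the formulas
_≅_ : Ctx → Ctx → Set
Γ ≅ Δ = Σ (Idx Γ ↔ Idx Δ) λ e → ∀ i → fm Δ (Inverse.to e i) ≡ fm Γ i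

_,,_ : Ctx → AForm → Ctx
Γ ,, A = ctx (Idx Γ ⊎ ⊤) λ { (inj₁ i) → fm Γ i ; (inj₂ _) → A }

_⊎ᶜ_ : Ctx → Ctx → Ctx
Γ ⊎ᶜ Δ = ctx (Idx Γ ⊎ Idx Δ) λ { (inj₁ i) → fm Γ i ; (inj₂ j) → fm Δ j }

_^∞ : AForm → Ctx
A ^∞ = ctx ℕ λ _ → A

⨄ : (ℕ → Ctx) → Ctx
⨄ Γs = ctx (Σ ℕ λ i → Idx (Γs i)) λ { (i , j) → fm (Γs i) j }

data ALV : Ctx → Set₁ where
  ax     : ∀ {Γ} P → ALV ((Γ ,, pos P) ,, neg P)
  ⊕₁     : ∀ {Γ A B} → ALV (Γ ,, A) → ALV (Γ ,, (A ⊕ B))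
  ⊕₂     : ∀ {Γ A B} → ALV (Γ ,, B) → ALV (Γ ,, (A ⊕ B))
  &-rule : ∀ {Γ A B} → ALV (Γ ,, A) → ALV (Γ ,, B) → ALV (Γ ,, (A & B))
  ⅋-rule : ∀ {Γ A B} → ALV ((Γ ,, A) ,, B) → ALV (Γ ,, (A ⅋ B))
  ⊗-rule : ∀ {Γ Δ A B} → ALV (Γ ,, A) → ALV (Δ ,, B) → ALV ((Γ ⊎ᶜ Δ) ,, (A ⊗ B))
  ∃-rule : ∀ {Γ A} → ALV (Γ ⊎ᶜ (A ^∞)) → ALV (Γ ,, ∃v A)
  ∀-rule : ∀ {Γs : ℕ → Ctx} {A} → (∀ i → ALV (Γs i ,, A)) → ALV (⨄ Γs ,, ∀v A)
  exch   : ∀ {Γ Δ} → Γ ≅ Δ → ALV Γ → ALV Δ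

_* : CForm → AForm
pos P * = pos P
neg P * = neg P
(A ∨ B) * = ∃v (A *) ⅋ ∃v (B *)
(A ∧ B) * = ∃v (A *) ⊗ ∃v (B *)

∃*_ : List CForm → Ctx
∃* Γ = ctx (Fin (length Γ)) λ i → ∃v (lookup Γ i *)

-- CL → ALV: a CL-derivation of Γ becomes an ALV-derivation of Δ, Γ*^∞, i.e. of every formula
-- of Γ* with infinitely many copies, next to an arbitrary context Δ. In each premise the
-- principal formula C* keeps its infinitely many copies inside Δ, so using one copy of it in
-- the conclusion costs nothing: this replaces contraction. The context-sharing ∧-rule becomes
-- ⊗ because Γ*^∞ splits into two copies of itself (ℕ ⊎ ℕ ↔ ℕ), and at the end the ∃-rule turns
-- each A*^∞ into ∃x A*.
-- ALV → CL: read ⊕, ⅋ as ∨ and &, ⊗ as ∧ and ignore the vacuous quantifiers; every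
-- ALV-derivable sequent is then classically valid, and CL is complete.
module Submission where

open import Defs
open import Data.List using (List)
open import Function.Bundles using (_⇔_)

open import Algebra.Bundles using (CommutativeMonoid)
open import Data.Bool using (Bool; true; false; T)
import Data.Bool as Bool
open import Data.Empty using (⊥-elim)
import Data.Empty.Polymorphic as Poly
open import Data.Fin using (zero; suc)
open import Data.List using ([]; _∷_; _++_; map; lookup)
open import Data.List.Membership.Propositional using (_∈_; find; lose)
open import Data.List.Membership.Propositional.Properties using (∈-∃++; ∈-map⁺; ∈-lookup)
open import Data.List.Properties using (++-identityʳ)
open import Data.List.Relation.Binary.Permutation.Propositional
  using (_↭_; refl; prep; swap; trans; ↭-sym; ↭-trans)
open import Data.List.Relation.Binary.Permutation.Propositional.Properties
  using (shift; ∈-resp-↭; Any-resp-↭; map⁺)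
open import Data.List.Relation.Unary.Any using (Any; here; there)
open import Data.List.Relation.Unary.Any.Properties using (map⁻)
open import Data.Nat as ℕ using (ℕ; zero; suc; _*_)
open import Data.Product using (∃; _×_; _,_; proj₁; proj₂)
open import Data.Product.Properties using (≡-dec)
open import Data.Sum as Sum using (_⊎_; inj₁; inj₂; [_,_])
open import Data.Sum.Algebra using (⊎-cong; ⊎-comm; ⊎-assoc; ⊎-identityˡ; ⊎-identityʳ)
open import Data.Unit using (⊤; tt)
open import Function using (const)
open import Function.Bundles using (_↔_; Inverse; mk↔ₛ′; mk⇔)
open import Function.Properties.Inverse using (↔-refl; ↔-sym; ↔-trans)
open import Level using (0ℓ)
open import Relation.Binary.PropositionalEquality as ≡ using (_≡_; cong; subst)
open import Relation.Nullary using (¬_; isYes; yes; no)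
open import Relation.Nullary.Decidable using (T?; toWitness; fromWitness)

open import Data.List.Membership.DecPropositional (≡-dec Bool._≟_ ℕ._≟_) using (_∈?_)

private variable
  Γ Γ′ Δ Δ′ Θ : Ctx
  A B : AForm
  As Bs : List AForm

[_]ᶜ : AForm → Ctx
[ A ]ᶜ = ctx ⊤ λ _ → A

∅ᶜ : Ctx
∅ᶜ = ctx Poly.⊥ Poly.⊥-elim

-- Unlike `_≅_`, which unfolds to a Σ-type, this wrapper lets Agda infer both contexts.
infix 4 _≈ᶜ_
record _≈ᶜ_ (Γ Δ : Ctx) : Set where
  constructor ⟨_⟩
  field ≈ᶜ⇒≅ : Γ ≅ Δ
open _≈ᶜ_

exchᶜ : Γ ≈ᶜ Δ → ALV Γ → ALV Δ
exchᶜ Γ≈Δ = exch (≈ᶜ⇒≅ Γ≈Δ)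

≈ᶜ-refl : Γ ≈ᶜ Γ
≈ᶜ-refl = ⟨ ↔-refl , (λ _ → ≡.refl) ⟩

≈ᶜ-sym : Γ ≈ᶜ Δ → Δ ≈ᶜ Γ
≈ᶜ-sym {Γ = Γ} {Δ = Δ} ⟨ e , p ⟩ = ⟨ ↔-sym e , fm-from ⟩
  where
  open Inverse e
  fm-from : ∀ j → fm Γ (from j) ≡ fm Δ j
  fm-from j = ≡.trans (≡.sym (p (from j))) (cong (fm Δ) (strictlyInverseˡ j))

≈ᶜ-trans : Γ ≈ᶜ Δ → Δ ≈ᶜ Θ → Γ ≈ᶜ Θ
≈ᶜ-trans ⟨ e , p ⟩ ⟨ f , q ⟩ = ⟨ ↔-trans e f , (λ i → ≡.trans (q (Inverse.to e i)) (p i)) ⟩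

⊎ᶜ-cong : Γ ≈ᶜ Γ′ → Δ ≈ᶜ Δ′ → (Γ ⊎ᶜ Δ) ≈ᶜ (Γ′ ⊎ᶜ Δ′)
⊎ᶜ-cong ⟨ e , p ⟩ ⟨ f , q ⟩ = ⟨ ⊎-cong e f , (λ { (inj₁ i) → p i ; (inj₂ j) → q j }) ⟩

⊎ᶜ-assoc : ∀ Γ Δ Θ → ((Γ ⊎ᶜ Δ) ⊎ᶜ Θ) ≈ᶜ (Γ ⊎ᶜ (Δ ⊎ᶜ Θ))
⊎ᶜ-assoc _ _ _ =
  ⟨ ⊎-assoc 0ℓ _ _ _
  , (λ { (inj₁ (inj₁ _)) → ≡.refl ; (inj₁ (inj₂ _)) → ≡.refl ; (inj₂ _) → ≡.refl }) ⟩

⊎ᶜ-comm : ∀ Γ Δ → (Γ ⊎ᶜ Δ) ≈ᶜ (Δ ⊎ᶜ Γ)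
⊎ᶜ-comm _ _ = ⟨ ⊎-comm _ _ , (λ { (inj₁ _) → ≡.refl ; (inj₂ _) → ≡.refl }) ⟩

⊎ᶜ-identityˡ : ∀ Γ → (∅ᶜ ⊎ᶜ Γ) ≈ᶜ Γ
⊎ᶜ-identityˡ _ = ⟨ ⊎-identityˡ 0ℓ _ , (λ { (inj₂ _) → ≡.refl }) ⟩

⊎ᶜ-identityʳ : ∀ Γ → (Γ ⊎ᶜ ∅ᶜ) ≈ᶜ Γ
⊎ᶜ-identityʳ _ = ⟨ ⊎-identityʳ 0ℓ _ , (λ { (inj₁ _) → ≡.refl }) ⟩

ctx-commutativeMonoid : CommutativeMonoid _ _
ctx-commutativeMonoid = record
  { Carrier = Ctx
  ; _≈_ = _≈ᶜ_
  ; _∙_ = _⊎ᶜ_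
  ; ε = ∅ᶜ
  ; isCommutativeMonoid = record
    { isMonoid = record
      { isSemigroup = record
        { isMagma = record
          { isEquivalence = record { refl = ≈ᶜ-refl ; sym = ≈ᶜ-sym ; trans = ≈ᶜ-trans }
          ; ∙-cong = ⊎ᶜ-cong
          }
        ; assoc = ⊎ᶜ-assoc
        }
      ; identity = ⊎ᶜ-identityˡ , ⊎ᶜ-identityʳ
      }
    ; comm = ⊎ᶜ-comm
    }
  }

open import Algebra.Solver.CommutativeMonoid ctx-commutativeMonoid
  using (solve; _⊜_; id) renaming (_⊕_ to _∪_)
open import Relation.Binary.Reasoning.Setoid (CommutativeMonoid.setoid ctx-commutativeMonoid)

ℕ⊎ℕ↔ℕ : (ℕ ⊎ ℕ) ↔ ℕ
ℕ⊎ℕ↔ℕ = mk↔ₛ′ interleave split interleave-split split-interleave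
  where
  interleave : ℕ ⊎ ℕ → ℕ
  interleave = [ (λ n → n * 2) , (λ n → suc (n * 2)) ]

  split : ℕ → ℕ ⊎ ℕ
  split zero = inj₁ zero
  split (suc zero) = inj₂ zero
  split (suc (suc n)) = Sum.map suc suc (split n)

  interleave-split : ∀ n → interleave (split n) ≡ n
  interleave-split zero = ≡.refl
  interleave-split (suc zero) = ≡.refl
  interleave-split (suc (suc n)) with split n | interleave-split n
  ... | inj₁ _ | ≡.refl = ≡.refl
  ... | inj₂ _ | ≡.refl = ≡.refl

  split-interleave : ∀ x → split (interleave x) ≡ x
  split-interleave (inj₁ zero) = ≡.refl
  split-interleave (inj₁ (suc n)) = cong (Sum.map suc suc) (split-interleave (inj₁ n))
  split-interleave (inj₂ zero) = ≡.refl
  split-interleave (inj₂ (suc n)) = cong (Sum.map suc suc) (split-interleave (inj₂ n))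

^∞-idem : ∀ A → ((A ^∞) ⊎ᶜ (A ^∞)) ≈ᶜ (A ^∞)
^∞-idem _ = ⟨ ℕ⊎ℕ↔ℕ , (λ { (inj₁ _) → ≡.refl ; (inj₂ _) → ≡.refl }) ⟩

^∞-absorb : ∀ A → ([ A ]ᶜ ⊎ᶜ (A ^∞)) ≈ᶜ (A ^∞)
^∞-absorb _ = ⟨
  mk↔ₛ′ [ const zero , suc ] (λ { zero → inj₁ tt ; (suc n) → inj₂ n })
        (λ { zero → ≡.refl ; (suc _) → ≡.refl }) (λ { (inj₁ _) → ≡.refl ; (inj₂ _) → ≡.refl })
  , (λ { (inj₁ _) → ≡.refl ; (inj₂ _) → ≡.refl }) ⟩

∞-copies : List AForm → Ctx
∞-copies [] = ∅ᶜ
∞-copies (A ∷ As) = (A ^∞) ⊎ᶜ ∞-copies As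

∞-copies-idem : ∀ As → (∞-copies As ⊎ᶜ ∞-copies As) ≈ᶜ ∞-copies As
∞-copies-idem [] = ⊎ᶜ-identityˡ ∅ᶜ
∞-copies-idem (A ∷ As) = begin
  ((A ^∞) ⊎ᶜ X) ⊎ᶜ ((A ^∞) ⊎ᶜ X)
    ≈⟨ solve 2 (λ a x → (a ∪ x) ∪ (a ∪ x) ⊜ (a ∪ a) ∪ (x ∪ x)) ≈ᶜ-refl (A ^∞) X ⟩
  ((A ^∞) ⊎ᶜ (A ^∞)) ⊎ᶜ (X ⊎ᶜ X)
    ≈⟨ ⊎ᶜ-cong (^∞-idem A) (∞-copies-idem As) ⟩
  (A ^∞) ⊎ᶜ X
    ∎
  where
  X : Ctx
  X = ∞-copies As

∞-copies-absorb : ∀ Δ As {A} → A ∈ As →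
                  ((Δ ⊎ᶜ ∞-copies As) ⊎ᶜ [ A ]ᶜ) ≈ᶜ (Δ ⊎ᶜ ∞-copies As)
∞-copies-absorb Δ (A ∷ As) (here ≡.refl) = begin
  (Δ ⊎ᶜ ((A ^∞) ⊎ᶜ X)) ⊎ᶜ [ A ]ᶜ
    ≈⟨ solve 4 (λ δ a x s → (δ ∪ (a ∪ x)) ∪ s ⊜ δ ∪ ((s ∪ a) ∪ x)) ≈ᶜ-refl Δ (A ^∞) X [ A ]ᶜ ⟩
  Δ ⊎ᶜ (([ A ]ᶜ ⊎ᶜ (A ^∞)) ⊎ᶜ X)
    ≈⟨ ⊎ᶜ-cong ≈ᶜ-refl (⊎ᶜ-cong (^∞-absorb A) ≈ᶜ-refl) ⟩
  Δ ⊎ᶜ ((A ^∞) ⊎ᶜ X)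
    ∎
  where
  X : Ctx
  X = ∞-copies As
∞-copies-absorb Δ (B ∷ As) {A} (there A∈As) = begin
  (Δ ⊎ᶜ ((B ^∞) ⊎ᶜ X)) ⊎ᶜ [ A ]ᶜ   ≈⟨ ⊎ᶜ-cong (≈ᶜ-sym (⊎ᶜ-assoc Δ (B ^∞) X)) ≈ᶜ-refl ⟩
  ((Δ ⊎ᶜ (B ^∞)) ⊎ᶜ X) ⊎ᶜ [ A ]ᶜ   ≈⟨ ∞-copies-absorb (Δ ⊎ᶜ (B ^∞)) As A∈As ⟩
  (Δ ⊎ᶜ (B ^∞)) ⊎ᶜ X               ≈⟨ ⊎ᶜ-assoc Δ (B ^∞) X ⟩
  Δ ⊎ᶜ ((B ^∞) ⊎ᶜ X)               ∎
  where
  X : Ctx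
  X = ∞-copies As

∞-copies-resp-↭ : As ↭ Bs → ∞-copies As ≈ᶜ ∞-copies Bs
∞-copies-resp-↭ refl = ≈ᶜ-refl
∞-copies-resp-↭ (prep A p) = ⊎ᶜ-cong ≈ᶜ-refl (∞-copies-resp-↭ p)
∞-copies-resp-↭ (swap {xs = As} A B p) = begin
  (A ^∞) ⊎ᶜ ((B ^∞) ⊎ᶜ ∞-copies As)
    ≈⟨ solve 3 (λ a b x → a ∪ (b ∪ x) ⊜ b ∪ (a ∪ x)) ≈ᶜ-refl (A ^∞) (B ^∞) (∞-copies As) ⟩
  (B ^∞) ⊎ᶜ ((A ^∞) ⊎ᶜ ∞-copies As)
    ≈⟨ ⊎ᶜ-cong ≈ᶜ-refl (⊎ᶜ-cong ≈ᶜ-refl (∞-copies-resp-↭ p)) ⟩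
  (B ^∞) ⊎ᶜ ((A ^∞) ⊎ᶜ ∞-copies _)
    ∎
∞-copies-resp-↭ (trans p q) = ≈ᶜ-trans (∞-copies-resp-↭ p) (∞-copies-resp-↭ q)

-- The rules of ALV with `Γ ,, A` read as `Γ ⊎ᶜ [ A ]ᶜ`, so that all structural bookkeeping
-- is left to the commutative-monoid solver.
,,≈ᶜ : ∀ Γ A → (Γ ,, A) ≈ᶜ (Γ ⊎ᶜ [ A ]ᶜ)
,,≈ᶜ _ _ = ⟨ ↔-refl , (λ { (inj₁ _) → ≡.refl ; (inj₂ _) → ≡.refl }) ⟩

,,²≈ᶜ : ∀ Γ A B → ((Γ ,, A) ,, B) ≈ᶜ ((Γ ⊎ᶜ [ A ]ᶜ) ⊎ᶜ [ B ]ᶜ)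
,,²≈ᶜ Γ A B = ≈ᶜ-trans (,,≈ᶜ (Γ ,, A) B) (⊎ᶜ-cong (,,≈ᶜ Γ A) ≈ᶜ-refl)

axᶜ : ∀ Γ P → ALV ((Γ ⊎ᶜ [ pos P ]ᶜ) ⊎ᶜ [ neg P ]ᶜ)
axᶜ Γ P = exchᶜ (,,²≈ᶜ Γ _ _) (ax P)

⅋-ruleᶜ : ALV ((Γ ⊎ᶜ [ A ]ᶜ) ⊎ᶜ [ B ]ᶜ) → ALV (Γ ⊎ᶜ [ A ⅋ B ]ᶜ)
⅋-ruleᶜ d = exchᶜ (,,≈ᶜ _ _) (⅋-rule (exchᶜ (≈ᶜ-sym (,,²≈ᶜ _ _ _)) d))

⊗-ruleᶜ : ALV (Γ ⊎ᶜ [ A ]ᶜ) → ALV (Δ ⊎ᶜ [ B ]ᶜ) → ALV ((Γ ⊎ᶜ Δ) ⊎ᶜ [ A ⊗ B ]ᶜ)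
⊗-ruleᶜ d e =
  exchᶜ (,,≈ᶜ _ _) (⊗-rule (exchᶜ (≈ᶜ-sym (,,≈ᶜ _ _)) d) (exchᶜ (≈ᶜ-sym (,,≈ᶜ _ _)) e))

∃-ruleᶜ : ALV (Γ ⊎ᶜ (A ^∞)) → ALV (Γ ⊎ᶜ [ ∃v A ]ᶜ)
∃-ruleᶜ d = exchᶜ (,,≈ᶜ _ _) (∃-rule d)

∃-rule∞ : ∀ As → ALV (Δ ⊎ᶜ ∞-copies (A ∷ As)) → ALV ((Δ ⊎ᶜ [ ∃v A ]ᶜ) ⊎ᶜ ∞-copies As)
∃-rule∞ {Δ} {A} As d =
  exchᶜ (solve 3 (λ δ x a → (δ ∪ x) ∪ a ⊜ (δ ∪ a) ∪ x) ≈ᶜ-refl Δ (∞-copies As) [ ∃v A ]ᶜ)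
    (∃-ruleᶜ (exchᶜ (solve 3 (λ δ a x → δ ∪ (a ∪ x) ⊜ (δ ∪ x) ∪ a) ≈ᶜ-refl Δ (A ^∞) (∞-copies As))
                    d))

CL→ALV-copies : ∀ {Γ} → CL Γ → ∀ Δ → ALV (Δ ⊎ᶜ ∞-copies (map _* Γ))
CL→ALV-copies (ax {Γ} P) Δ = exchᶜ absorb-P-P̄ (axᶜ (Δ ⊎ᶜ ∞-copies Ps) P)
  where
  Ps : List AForm
  Ps = map _* (pos P ∷ neg P ∷ Γ)
  absorb-P-P̄ : (((Δ ⊎ᶜ ∞-copies Ps) ⊎ᶜ [ pos P ]ᶜ) ⊎ᶜ [ neg P ]ᶜ) ≈ᶜ (Δ ⊎ᶜ ∞-copies Ps)
  absorb-P-P̄ = ≈ᶜ-trans (⊎ᶜ-cong (∞-copies-absorb Δ Ps (here ≡.refl)) ≈ᶜ-refl)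
                        (∞-copies-absorb Δ Ps (there (here ≡.refl)))
CL→ALV-copies (∨-rule {Γ} {A} {B} d) Δ =
  exchᶜ (∞-copies-absorb Δ (map _* ((A ∨ B) ∷ Γ)) (here ≡.refl)) (⅋-ruleᶜ (exchᶜ regroup ∃A∃B))
  where
  C∞ X : Ctx
  C∞ = ((A ∨ B) *) ^∞
  X = ∞-copies (map _* Γ)
  ∃A∃B : ALV ((((Δ ⊎ᶜ C∞) ⊎ᶜ [ ∃v (A *) ]ᶜ) ⊎ᶜ [ ∃v (B *) ]ᶜ) ⊎ᶜ X)
  ∃A∃B = ∃-rule∞ (map _* Γ) (∃-rule∞ (map _* (B ∷ Γ)) (CL→ALV-copies d (Δ ⊎ᶜ C∞)))
  regroup : ((((Δ ⊎ᶜ C∞) ⊎ᶜ [ ∃v (A *) ]ᶜ) ⊎ᶜ [ ∃v (B *) ]ᶜ) ⊎ᶜ X)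
            ≈ᶜ (((Δ ⊎ᶜ (C∞ ⊎ᶜ X)) ⊎ᶜ [ ∃v (A *) ]ᶜ) ⊎ᶜ [ ∃v (B *) ]ᶜ)
  regroup = solve 5 (λ δ c a b x → (((δ ∪ c) ∪ a) ∪ b) ∪ x ⊜ ((δ ∪ (c ∪ x)) ∪ a) ∪ b)
                    ≈ᶜ-refl Δ C∞ [ ∃v (A *) ]ᶜ [ ∃v (B *) ]ᶜ X
CL→ALV-copies (∧-rule {Γ} {A} {B} d e) Δ =
  exchᶜ (∞-copies-absorb Δ (map _* ((A ∧ B) ∷ Γ)) (here ≡.refl))
    (exchᶜ (⊎ᶜ-cong merge ≈ᶜ-refl) (⊗-ruleᶜ left right))
  where
  C∞ X : Ctx
  C∞ = ((A ∧ B) *) ^∞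
  X = ∞-copies (map _* Γ)
  left : ALV (((Δ ⊎ᶜ C∞) ⊎ᶜ X) ⊎ᶜ [ ∃v (A *) ]ᶜ)
  left = exchᶜ (solve 3 (λ δ a x → (δ ∪ a) ∪ x ⊜ (δ ∪ x) ∪ a) ≈ᶜ-refl (Δ ⊎ᶜ C∞) [ ∃v (A *) ]ᶜ X)
           (∃-rule∞ (map _* Γ) (CL→ALV-copies d (Δ ⊎ᶜ C∞)))
  right : ALV (X ⊎ᶜ [ ∃v (B *) ]ᶜ)
  right = exchᶜ (solve 2 (λ b x → (id ∪ b) ∪ x ⊜ x ∪ b) ≈ᶜ-refl [ ∃v (B *) ]ᶜ X)
            (∃-rule∞ (map _* Γ) (CL→ALV-copies e ∅ᶜ))
  merge : (((Δ ⊎ᶜ C∞) ⊎ᶜ X) ⊎ᶜ X) ≈ᶜ (Δ ⊎ᶜ (C∞ ⊎ᶜ X))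
  merge = begin
    ((Δ ⊎ᶜ C∞) ⊎ᶜ X) ⊎ᶜ X   ≈⟨ ⊎ᶜ-assoc (Δ ⊎ᶜ C∞) X X ⟩
    (Δ ⊎ᶜ C∞) ⊎ᶜ (X ⊎ᶜ X)   ≈⟨ ⊎ᶜ-cong ≈ᶜ-refl (∞-copies-idem (map _* Γ)) ⟩
    (Δ ⊎ᶜ C∞) ⊎ᶜ X          ≈⟨ ⊎ᶜ-assoc Δ C∞ X ⟩
    Δ ⊎ᶜ (C∞ ⊎ᶜ X)          ∎
CL→ALV-copies (exch Γ↭Γ′ d) Δ =
  exchᶜ (⊎ᶜ-cong ≈ᶜ-refl (∞-copies-resp-↭ (map⁺ _* Γ↭Γ′))) (CL→ALV-copies d Δ)

∃*-[] : ∅ᶜ ≈ᶜ ∃* []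
∃*-[] = ⟨ mk↔ₛ′ Poly.⊥-elim (λ ()) (λ ()) (λ ()) , (λ ()) ⟩

∃*-∷ : ∀ A Γ → ∃* (A ∷ Γ) ≈ᶜ ([ ∃v (A *) ]ᶜ ⊎ᶜ (∃* Γ))
∃*-∷ _ _ =
  ⟨ mk↔ₛ′ (λ { zero → inj₁ tt ; (suc i) → inj₂ i }) [ const zero , suc ]
          (λ { (inj₁ _) → ≡.refl ; (inj₂ _) → ≡.refl }) (λ { zero → ≡.refl ; (suc _) → ≡.refl })
  , (λ { zero → ≡.refl ; (suc _) → ≡.refl }) ⟩

∃-rule-copies : ∀ Γ → ALV (Δ ⊎ᶜ ∞-copies (map _* Γ)) → ALV (Δ ⊎ᶜ (∃* Γ))
∃-rule-copies [] d = exchᶜ (⊎ᶜ-cong ≈ᶜ-refl ∃*-[]) d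
∃-rule-copies {Δ} (A ∷ Γ) d =
  exchᶜ (≈ᶜ-trans (⊎ᶜ-assoc Δ _ _) (⊎ᶜ-cong ≈ᶜ-refl (≈ᶜ-sym (∃*-∷ A Γ))))
    (∃-rule-copies Γ (∃-rule∞ (map _* Γ) d))

CL→ALV : ∀ {Γ} → CL Γ → ALV (∃* Γ)
CL→ALV {Γ} d = exchᶜ (⊎ᶜ-identityˡ _) (∃-rule-copies Γ (CL→ALV-copies d ∅ᶜ))

Valuation : Set
Valuation = ℕ → Bool

_⊨_ : Valuation → CForm → Set
v ⊨ pos P = T (v P)
v ⊨ neg P = ¬ T (v P)
v ⊨ (A ∧ B) = v ⊨ A × v ⊨ B
v ⊨ (A ∨ B) = v ⊨ A ⊎ v ⊨ B

_⊨ᴬ_ : Valuation → AForm → Set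
v ⊨ᴬ pos P = T (v P)
v ⊨ᴬ neg P = ¬ T (v P)
v ⊨ᴬ (A ⊕ B) = v ⊨ᴬ A ⊎ v ⊨ᴬ B
v ⊨ᴬ (A & B) = v ⊨ᴬ A × v ⊨ᴬ B
v ⊨ᴬ (A ⅋ B) = v ⊨ᴬ A ⊎ v ⊨ᴬ B
v ⊨ᴬ (A ⊗ B) = v ⊨ᴬ A × v ⊨ᴬ B
v ⊨ᴬ ∀v A = v ⊨ᴬ A
v ⊨ᴬ ∃v A = v ⊨ᴬ A

_⊨ᶜ_ : Valuation → Ctx → Set
v ⊨ᶜ Γ = ∃ λ i → v ⊨ᴬ fm Γ i

⊨ᴬ*⇒⊨ : ∀ {v} A → v ⊨ᴬ (A *) → v ⊨ A
⊨ᴬ*⇒⊨ (pos P) t = t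
⊨ᴬ*⇒⊨ (neg P) t = t
⊨ᴬ*⇒⊨ (A ∧ B) (s , t) = ⊨ᴬ*⇒⊨ A s , ⊨ᴬ*⇒⊨ B t
⊨ᴬ*⇒⊨ (A ∨ B) (inj₁ s) = inj₁ (⊨ᴬ*⇒⊨ A s)
⊨ᴬ*⇒⊨ (A ∨ B) (inj₂ t) = inj₂ (⊨ᴬ*⇒⊨ B t)

,,-map : ∀ {v Γ A B} → (v ⊨ᴬ A → v ⊨ᴬ B) → v ⊨ᶜ (Γ ,, A) → v ⊨ᶜ (Γ ,, B)
,,-map f (inj₁ i , t) = inj₁ i , t
,,-map f (inj₂ _ , t) = inj₂ tt , f t

ALV-sound : ∀ {Θ} → ALV Θ → ∀ v → v ⊨ᶜ Θ
ALV-sound (ax P) v with T? (v P)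
... | yes t = inj₁ (inj₂ tt) , t
... | no ¬t = inj₂ tt , ¬t
ALV-sound (⊕₁ d) v = ,,-map inj₁ (ALV-sound d v)
ALV-sound (⊕₂ d) v = ,,-map inj₂ (ALV-sound d v)
ALV-sound (&-rule d e) v with ALV-sound d v | ALV-sound e v
... | inj₁ i , s | _ = inj₁ i , s
... | inj₂ _ , _ | inj₁ i , t = inj₁ i , t
... | inj₂ _ , s | inj₂ _ , t = inj₂ tt , (s , t)
ALV-sound (⅋-rule d) v with ALV-sound d v
... | inj₁ (inj₁ i) , s = inj₁ i , s
... | inj₁ (inj₂ _) , s = inj₂ tt , inj₁ s
... | inj₂ _ , t = inj₂ tt , inj₂ t
ALV-sound (⊗-rule d e) v with ALV-sound d v | ALV-sound e v
... | inj₁ i , s | _ = inj₁ (inj₁ i) , s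
... | inj₂ _ , _ | inj₁ j , t = inj₁ (inj₂ j) , t
... | inj₂ _ , s | inj₂ _ , t = inj₂ tt , (s , t)
ALV-sound (∃-rule d) v with ALV-sound d v
... | inj₁ i , s = inj₁ i , s
... | inj₂ _ , s = inj₂ tt , s
ALV-sound (∀-rule ds) v with ALV-sound (ds 0) v
... | inj₁ i , s = inj₁ (0 , i) , s
... | inj₂ _ , s = inj₂ tt , s
ALV-sound (exch (e , p) d) v with ALV-sound d v
... | i , s = Inverse.to e i , subst (v ⊨ᴬ_) (≡.sym (p i)) s

Valid : List CForm → Set
Valid Γ = ∀ v → Any (v ⊨_) Γ

∈⇒↭∷ : ∀ {x : CForm} {xs} → x ∈ xs → ∃ λ ys → xs ↭ x ∷ ys
∈⇒↭∷ x∈xs with ys , zs , ≡.refl ← ∈-∃++ x∈xs = ys ++ zs , shift _ ys zs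

CL-ax-∈ : ∀ {P Γ} → pos P ∈ Γ → neg P ∈ Γ → CL Γ
CL-ax-∈ P∈Γ P̄∈Γ with Δ , Γ↭PΔ ← ∈⇒↭∷ P∈Γ with ∈-resp-↭ Γ↭PΔ P̄∈Γ
... | there P̄∈Δ with Θ , Δ↭P̄Θ ← ∈⇒↭∷ P̄∈Δ = exch (↭-sym (↭-trans Γ↭PΔ (prep _ Δ↭P̄Θ))) (ax _)

literal : Bool × ℕ → CForm
literal (true , P) = pos P
literal (false , P) = neg P

-- Makes every literal of L false unless L also contains its complement.
countermodel : List (Bool × ℕ) → Valuation
countermodel L P = isYes ((false , P) ∈? L)

literals-complete : ∀ L → Valid (map literal L) → CL (map literal L)
literals-complete L valid with find (map⁻ (valid (countermodel L)))
... | (true , P) , P∈L , t = CL-ax-∈ (∈-map⁺ literal P∈L) (∈-map⁺ literal (toWitness t))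
... | (false , P) , P̄∈L , ¬t = ⊥-elim (¬t (fromWitness P̄∈L))

-- Validity is preserved backwards by every CL rule, so a valid sequent can be decomposed
-- formula by formula until only literals remain.
CompleteAbove : List CForm → Set
CompleteAbove Γ = ∀ L → Valid (Γ ++ map literal L) → CL (Γ ++ map literal L)

Valid-resp-↭ : ∀ {Γ Δ} → Γ ↭ Δ → Valid Γ → Valid Δ
Valid-resp-↭ Γ↭Δ valid v = Any-resp-↭ Γ↭Δ (valid v)

Valid-head : ∀ {A B Γ} → (∀ {v} → v ⊨ A → v ⊨ B) → Valid (A ∷ Γ) → Valid (B ∷ Γ)
Valid-head f valid v with valid v
... | here t = here (f t)
... | there t = there t

Valid-∨ : ∀ {A B Γ} → Valid ((A ∨ B) ∷ Γ) → Valid (A ∷ B ∷ Γ)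
Valid-∨ valid v with valid v
... | here (inj₁ s) = here s
... | here (inj₂ t) = there (here t)
... | there t = there (there t)

complete-literal : ∀ ℓ {Γ} → CompleteAbove Γ → CompleteAbove (literal ℓ ∷ Γ)
complete-literal ℓ {Γ} complete L valid =
  exch moveℓ (complete (ℓ ∷ L) (Valid-resp-↭ (↭-sym moveℓ) valid))
  where
  moveℓ : Γ ++ literal ℓ ∷ map literal L ↭ literal ℓ ∷ Γ ++ map literal L
  moveℓ = shift (literal ℓ) Γ (map literal L)

complete-∷ : ∀ A {Γ} → CompleteAbove Γ → CompleteAbove (A ∷ Γ)
complete-∷ (pos P) = complete-literal (true , P)
complete-∷ (neg P) = complete-literal (false , P)
complete-∷ (A ∧ B) complete L valid =
  ∧-rule (complete-∷ A complete L (Valid-head proj₁ valid))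
         (complete-∷ B complete L (Valid-head proj₂ valid))
complete-∷ (A ∨ B) complete L valid =
  ∨-rule (complete-∷ A (complete-∷ B complete) L (Valid-∨ valid))

complete-above : ∀ Γ → CompleteAbove Γ
complete-above [] = literals-complete
complete-above (A ∷ Γ) = complete-∷ A (complete-above Γ)

CL-complete : ∀ {Γ} → Valid Γ → CL Γ
CL-complete {Γ} valid =
  subst CL (++-identityʳ Γ) (complete-above Γ [] (subst Valid (≡.sym (++-identityʳ Γ)) valid))

ALV→CL : ∀ {Γ} → ALV (∃* Γ) → CL Γ
ALV→CL {Γ} d = CL-complete λ v →
  let i , t = ALV-sound d v in lose (∈-lookup i) (⊨ᴬ*⇒⊨ (lookup Γ i) t)

mainTheorem11 : (Γ : List CForm) → CL Γ ⇔ ALV (∃* Γ)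
mainTheorem11 Γ = mk⇔ CL→ALV ALV→CL
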